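{- Let $n,m\in\mathbb{N}$ with $\lfloor n\phi\rfloor=\lfloor m(\phi+1)\rfloor+1$. Let $(x,y)\in\mathbb{Z}_{\geq0}^2$ with $(x,y)\notin P_1$ and $y=\lfloor n\phi\rfloor$ or $y=\lfloor n\phi\rfloor-1$. Then some position reachable from $(x,y)$ in one queen move lies in $P_1$.
   Context: $\phi=\frac{1+\sqrt5}2$; $\mathbb{N}$ is the positive integers. Queen moves from $(x,y)$: to $(u,y)$ with $0\le u<x$, to $(x,v)$ with $0\le v<y$, or to $(x-t,y-t)$ with $1\le t\le\min(x,y)$. $g:\mathbb{Z}_{\geq0}\to\{0,1\}$ is defined by $g(0)=1$, $g(1)=0$ and, for $k\ge2$, $g(k)=1-g(j)$ if there is $j\in\mathbb{Z}_{\geq0}$ with $\lfloor k\phi\rfloor=\lfloor j(\phi+1)\rfloor+1$, and $g(k)=1$ otherwise. $P_1=\{(\lfloor k\phi\rfloor+g(k)-1,\lfloor k(\phi+1)\rfloor+g(k)):k\ge0\}\cup\{(\lfloor k(\phi+1)\rfloor+g(k),\lfloor k\phi\rfloor+g(k)-1):k\ge0\}\cup\{(0,0),(1,1)\}$. -}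

module Defs where

open import Data.Nat using (ℕ; zero; suc; _+_; _*_; _∸_; _≤_; _<_; _≤ᵇ_; _≡ᵇ_)
open import Data.Nat.DivMod using (_/_)
open import Data.Bool using (if_then_else_)
open import Data.Maybe using (Maybe; just; nothing)
open import Data.Product using (Σ; ∃; _×_; _,_)
open import Data.Sum using (_⊎_)
open import Relation.Binary.PropositionalEquality using (_≡_)

isqrt : ℕ → ℕ
isqrt zero = 0
isqrt (suc N) with isqrt N
... | s = if (suc s * suc s) ≤ᵇ suc N then suc s else s

-- ⌊k φ⌋ = ⌊(k + k√5)/2⌋ = ⌊(k + ⌊√(5k²)⌋)/2⌋   (φ = (1+√5)/2)
floorφ : ℕ → ℕ
floorφ k = (k + isqrt (5 * (k * k))) / 2

-- ⌊k (φ+1)⌋ = ⌊k φ⌋ + k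
floorφ1 : ℕ → ℕ
floorφ1 k = floorφ k + k

-- search for j < k with ⌊kφ⌋ = ⌊j(φ+1)⌋ + 1 (any such j satisfies j < k;
-- it is unique since j ↦ ⌊j(φ+1)⌋ is strictly increasing)
findJ : ℕ → Maybe ℕ
findJ k = go k
  where
  go : ℕ → Maybe ℕ
  go zero = nothing
  go (suc i) = if floorφ k ≡ᵇ (floorφ1 i + 1) then just i else go i

-- g with fuel (fuel ≥ k guarantees the intended value)
gF : ℕ → ℕ → ℕ
gF _ zero = 1
gF _ (suc zero) = 0
gF zero (suc (suc _)) = 1
gF (suc f) k@(suc (suc _)) with findJ k
... | just j = 1 ∸ gF f j
... | nothing = 1

g : ℕ → ℕ
g k = gF k k

InP1 : ℕ → ℕ → Set
InP1 x y =
  (∃ λ k → x ≡ (floorφ k + g k) ∸ 1 × y ≡ floorφ1 k + g k)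
  ⊎ (∃ λ k → x ≡ floorφ1 k + g k × y ≡ (floorφ k + g k) ∸ 1)
  ⊎ (x ≡ 0 × y ≡ 0)
  ⊎ (x ≡ 1 × y ≡ 1)

QueenMove : ℕ → ℕ → ℕ → ℕ → Set
QueenMove x y u v =
  (u < x × v ≡ y)
  ⊎ (u ≡ x × v < y)
  ⊎ (∃ λ t → 1 ≤ t × t ≤ x × t ≤ y × u ≡ x ∸ t × v ≡ y ∸ t)

{-# OPTIONS --safe #-}
-- Write the k-th pair of P₁ as (a₁ k , b₁ k), so that b₁ k = a₁ k + k + 1.
-- Since ⌊kφ⌋ and ⌊k(φ+1)⌋ are complementary Beatty sequences, every x is some
-- a₁ k or b₁ k (when g k = 0, the value ⌊kφ⌋ = ⌊j(φ+1)⌋ + 1 is b₁ j); moreover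
-- a₁ is nondecreasing. Take x < y. If x = b₁ k, move down to (b₁ k , a₁ k). If
-- x = a₁ k and b₁ k < y, move down to (a₁ k , b₁ k). If y < b₁ k, the pair whose
-- difference is y − x has index j < k, so a₁ j ≤ x and that pair lies diagonally
-- below (x , y). The case x > y is symmetric, and (x , x) moves to (0 , 0).
-- The facts about ⌊kφ⌋ all come from a ≤ ⌊kφ⌋ ⟺ a² ≤ ak + k² and the
-- irrationality of φ.
module Submission where

open import Defs
open import Data.Bool using (true; false; if_then_else_)
open import Data.List.Base using (_∷_; [])
open import Data.Maybe using (Maybe; just; nothing)
open import Data.Nat
open import Data.Nat.DivMod using (_/_; m/n*n≤m; m*n/n≡m; /-monoˡ-≤)
open import Data.Nat.Induction using (<-rec)
open import Data.Nat.Properties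
open import Data.Nat.Tactic.RingSolver using (solve-∀; solve)
open import Data.Product using (∃; _×_; _,_; proj₁; map₁)
open import Data.Sum using (_⊎_; inj₁; inj₂)
open import Function.Base using (_∘_)
open import Function.Bundles using (_⇔_; mk⇔; Equivalence)
open import Function.Construct.Symmetry using (⇔-sym)
open import Function.Properties.Equivalence using (⇔-setoid)
open import Level using (0ℓ)
open import Relation.Binary using (tri<; tri≈; tri>)
open import Relation.Binary.PropositionalEquality
import Relation.Binary.Reasoning.Setoid as SetoidReasoning
open import Relation.Nullary using (¬_; contradiction; yes; no)
open import Relation.Nullary.Reflects using (Reflects; ofʸ; ofⁿ; fromEquivalence)

open Equivalence using (to; from)
open import Algebra.Properties.CommutativeSemigroup +-commutativeSemigroup using (xy∙z≈xz∙y)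

isqrt-bounds : ∀ N → isqrt N * isqrt N ≤ N × N < suc (isqrt N) * suc (isqrt N)
isqrt-bounds zero = z≤n , s≤s z≤n
isqrt-bounds (suc N) with isqrt N | isqrt-bounds N
... | s | lo , hi with suc s * suc s ≤ᵇ suc N | ≤ᵇ-reflects-≤ (suc s * suc s) (suc N)
... | true  | ofʸ grows = grows , <-≤-trans (s≤s hi) (*-mono-< (n<1+n (suc s)) (n<1+n (suc s)))
... | false | ofⁿ stays = m≤n⇒m≤1+n lo , ≰⇒> stays

≤isqrt⇔ : ∀ {t N} → t ≤ isqrt N ⇔ t * t ≤ N
≤isqrt⇔ {t} {N} with isqrt-bounds N
... | lo , hi = mk⇔
  (λ t≤s → ≤-trans (*-mono-≤ t≤s t≤s) lo)
  (λ t²≤N → ≮⇒≥ λ s<t → <⇒≱ hi (≤-trans (*-mono-≤ s<t s<t) t²≤N))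

≤/⇔*≤ : ∀ {a m} n .{{_ : NonZero n}} → a ≤ m / n ⇔ a * n ≤ m
≤/⇔*≤ {a} {m} n = mk⇔
  (λ a≤m/n → ≤-trans (*-monoˡ-≤ n a≤m/n) (m/n*n≤m m n))
  (λ an≤m → subst (_≤ m / n) (m*n/n≡m a n) (/-monoˡ-≤ n an≤m))

-- φ is the positive root of x² = x + 1, so this says a ≤ kφ (for every k).
infix 4 _≤[_]φ
_≤[_]φ : ℕ → ℕ → Set
a ≤[ k ]φ = a * a ≤ a * k + k * k

≤[]φ⇔doubled : ∀ a k t → a * 2 ≡ k + t → a ≤[ k ]φ ⇔ t * t ≤ 5 * (k * k)
≤[]φ⇔doubled a k t 2a≡k+t = mk⇔
  (λ q → +-cancelˡ-≤ (k * k + 2 * k * t) _ _ (subst₂ _≤_ lhs rhs (*-monoʳ-≤ 4 q)))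
  (λ q → *-cancelˡ-≤ 4 (subst₂ _≤_ (sym lhs) (sym rhs) (+-monoʳ-≤ (k * k + 2 * k * t) q)))
  where
  open ≡-Reasoning
  lhs : 4 * (a * a) ≡ k * k + 2 * k * t + t * t
  lhs = begin
    4 * (a * a)                      ≡⟨ solve (a ∷ []) ⟩
    a * 2 * (a * 2)                  ≡⟨ cong (λ x → x * x) 2a≡k+t ⟩
    (k + t) * (k + t)                ≡⟨ solve (k ∷ t ∷ []) ⟩
    k * k + 2 * k * t + t * t        ∎
  rhs : 4 * (a * k + k * k) ≡ k * k + 2 * k * t + 5 * (k * k)
  rhs = begin
    4 * (a * k + k * k)              ≡⟨ solve (a ∷ k ∷ []) ⟩
    2 * (a * 2) * k + 4 * (k * k)    ≡⟨ cong (λ x → 2 * x * k + 4 * (k * k)) 2a≡k+t ⟩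
    2 * (k + t) * k + 4 * (k * k)    ≡⟨ solve (k ∷ t ∷ []) ⟩
    k * k + 2 * k * t + 5 * (k * k)  ∎

≤floorφ⇔≤[]φ : ∀ a k → a ≤ floorφ k ⇔ a ≤[ k ]φ
≤floorφ⇔≤[]φ a k with ≤-total (a * 2) k
... | inj₁ 2a≤k = mk⇔ (λ _ → a≤[k]φ) (λ _ → from (≤/⇔*≤ 2) (≤-trans 2a≤k (m≤m+n k _)))
  where
  a≤[k]φ : a ≤[ k ]φ
  a≤[k]φ = ≤-trans (*-monoʳ-≤ a (≤-trans (m≤m*n a 2) 2a≤k)) (m≤m+n (a * k) (k * k))
... | inj₂ k≤2a with m≤n⇒∃[o]m+o≡n k≤2a
... | t , k+t≡2a = begin
  a ≤ floorφ k                     ≈⟨ ≤/⇔*≤ 2 ⟩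
  a * 2 ≤ k + isqrt (5 * (k * k))  ≡⟨ cong (_≤ k + isqrt (5 * (k * k))) (sym k+t≡2a) ⟩
  k + t ≤ k + isqrt (5 * (k * k))  ≈⟨ mk⇔ (+-cancelˡ-≤ k _ _) (+-monoʳ-≤ k) ⟩
  t ≤ isqrt (5 * (k * k))          ≈⟨ ≤isqrt⇔ ⟩
  t * t ≤ 5 * (k * k)              ≈⟨ ⇔-sym (≤[]φ⇔doubled a k t (sym k+t≡2a)) ⟩
  a ≤[ k ]φ                        ∎
  where open SetoidReasoning (⇔-setoid 0ℓ)

+≡+⇒≤⇔≥ : ∀ {a b c d} → a + b ≡ c + d → a ≤ c ⇔ d ≤ b
+≡+⇒≤⇔≥ {a} {b} {c} {d} eq = mk⇔
  (λ a≤c → +-cancelˡ-≤ c d b (subst (_≤ c + b) eq (+-monoˡ-≤ b a≤c)))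
  (λ d≤b → +-cancelʳ-≤ d a c (subst (a + d ≤_) eq (+-monoʳ-≤ a d≤b)))

-- x ↦ 1 + 1/x exchanges the two sides of φ: (p + j)/p ≤ φ iff φ ≤ p/j.
φ-shift : ∀ p j → (p + j) * (p + j) + p * p ≡ ((p + j) * p + p * p) + (p * j + j * j)
φ-shift = solve-∀

+≤[]φ⇔ : ∀ p j → p + j ≤[ p ]φ ⇔ p * j + j * j ≤ p * p
+≤[]φ⇔ p j = +≡+⇒≤⇔≥ (φ-shift p j)

square≤0⇒≡0 : ∀ {a} → a * a ≤ 0 → a ≡ 0
square≤0⇒≡0 {a} a²≤0 with m*n≡0⇒m≡0∨n≡0 a (n≤0⇒n≡0 a²≤0)
... | inj₁ a≡0 = a≡0
... | inj₂ a≡0 = a≡0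

φ-irrational : ∀ a k → a * a ≡ a * k + k * k → a ≡ 0
φ-irrational = <-rec _ descent
  where
  open ≤-Reasoning
  descent : ∀ a → (∀ {a′} → a′ < a → ∀ k → a′ * a′ ≡ a′ * k + k * k → a′ ≡ 0) →
            ∀ k → a * a ≡ a * k + k * k → a ≡ 0
  descent a rec k eq with a ≤? k
  ... | yes a≤k = square≤0⇒≡0 (≤-trans (*-mono-≤ a≤k a≤k) k²≤0)
    where
    k²≤0 : k * k ≤ 0
    k²≤0 = +-cancelˡ-≤ (a * k) (k * k) 0 (begin
      a * k + k * k  ≡⟨ sym eq ⟩
      a * a          ≤⟨ *-monoʳ-≤ a a≤k ⟩
      a * k          ≡⟨ sym (+-identityʳ (a * k)) ⟩
      a * k + 0      ∎)
  ... | no a≰k with m≤n⇒∃[o]m+o≡n (<⇒≤ (≰⇒> a≰k))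
  ... | c , refl = square≤0⇒≡0 (begin
      (k + c) * (k + c)    ≡⟨ eq ⟩
      (k + c) * k + k * k  ≡⟨ cong (λ z → (k + c) * z + z * z) k≡0 ⟩
      (k + c) * 0 + 0      ≡⟨ cong (_+ 0) (*-zeroʳ (k + c)) ⟩
      0                    ∎)
    where
    -- by φ-shift, the solution (k + c , k) yields the smaller solution (k , c)
    k≡0 : k ≡ 0
    k≡0 = rec (≰⇒> a≰k) c (+-cancelˡ-≡ ((k + c) * k + k * k) _ _
            (trans (cong (_+ k * k) (sym eq)) (φ-shift k c)))

≤[]φ⇒≤k+k : ∀ a k → a ≤[ k ]φ → a ≤ k + k
≤[]φ⇒≤k+k a k a≤[k]φ with ≤-total a k
... | inj₁ a≤k = ≤-trans a≤k (m≤m+n k k)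
... | inj₂ k≤a with m≤n⇒∃[o]m+o≡n k≤a
... | j , refl = +-monoʳ-≤ k (≮⇒≥ λ k<j → <⇒≱ (*-mono-< k<j k<j) j²≤k²)
  where
  j²≤k² : j * j ≤ k * k
  j²≤k² = ≤-trans (m≤n+m (j * j) (k * j)) (to (+≤[]φ⇔ k j) a≤[k]φ)

≤[]φ-suc : ∀ a k → a ≤[ k ]φ → suc a ≤[ suc k ]φ
≤[]φ-suc a k a≤[k]φ = begin
  suc a * suc a                              ≡⟨ solve (a ∷ []) ⟩
  a * a + (a + suc a)                        ≤⟨ +-mono-≤ a≤[k]φ (+-monoʳ-≤ a (s≤s (≤[]φ⇒≤k+k a k a≤[k]φ))) ⟩
  a * k + k * k + (a + suc (k + k))          ≤⟨ m≤m+n _ (suc k) ⟩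
  a * k + k * k + (a + suc (k + k)) + suc k  ≡⟨ solve (a ∷ k ∷ []) ⟩
  suc a * suc k + suc k * suc k              ∎
  where open ≤-Reasoning

k≤floorφ : ∀ k → k ≤ floorφ k
k≤floorφ k = from (≤floorφ⇔≤[]φ k k) (m≤m+n (k * k) (k * k))

floorφ-suc : ∀ k → floorφ k < floorφ (suc k)
floorφ-suc k =
  from (≤floorφ⇔≤[]φ _ (suc k)) (≤[]φ-suc (floorφ k) k (to (≤floorφ⇔≤[]φ _ k) ≤-refl))

floorφ-mono-< : ∀ {j k} → j < k → floorφ j < floorφ k
floorφ-mono-< {j} {suc k} j<1+k with m<1+n⇒m<n∨m≡n j<1+k
... | inj₁ j<k = <-trans (floorφ-mono-< j<k) (floorφ-suc k)
... | inj₂ refl = floorφ-suc k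

floorφ-mono-≤ : ∀ {j k} → j ≤ k → floorφ j ≤ floorφ k
floorφ-mono-≤ j≤k with m≤n⇒m<n∨m≡n j≤k
... | inj₁ j<k = <⇒≤ (floorφ-mono-< j<k)
... | inj₂ refl = ≤-refl

floorφ1-mono-≤ : ∀ {j k} → j ≤ k → floorφ1 j ≤ floorφ1 k
floorφ1-mono-≤ j≤k = +-mono-≤ (floorφ-mono-≤ j≤k) j≤k

floorφ1-mono-< : ∀ {j k} → j < k → floorφ1 j < floorφ1 k
floorφ1-mono-< j<k = +-mono-<-≤ (floorφ-mono-< j<k) (<⇒≤ j<k)

floorφ1-injective : ∀ {j j′} → floorφ1 j ≡ floorφ1 j′ → j ≡ j′
floorφ1-injective {j} {j′} eq with <-cmp j j′
... | tri< j<j′ _ _ = contradiction eq (<⇒≢ (floorφ1-mono-< j<j′))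
... | tri≈ _ j≡j′ _ = j≡j′
... | tri> _ _ j′<j = contradiction eq (≢-sym (<⇒≢ (floorφ1-mono-< j′<j)))

floorφ1-suc : ∀ j → 2 + floorφ1 j ≤ floorφ1 (suc j)
floorφ1-suc j = subst (_≤ floorφ1 (suc j)) (cong suc (+-suc (floorφ j) j)) (+-monoˡ-≤ (suc j) (floorφ-suc j))

floorφ1-nonconsecutive : ∀ j j′ → floorφ1 j′ ≢ suc (floorφ1 j)
floorφ1-nonconsecutive j j′ eq with ≤-<-connex j′ j
... | inj₁ j′≤j = <⇒≱ (n<1+n (floorφ1 j)) (subst (_≤ floorφ1 j) eq (floorφ1-mono-≤ j′≤j))
... | inj₂ j<j′ = <⇒≱ (n<1+n (suc (floorφ1 j)))
                      (subst (2 + floorφ1 j ≤_) eq (≤-trans (floorφ1-suc j) (floorφ1-mono-≤ j<j′)))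

floorφ-bracket : ∀ N → ∃ λ k → floorφ k ≤ N × N < floorφ (suc k)
floorφ-bracket zero = 0 , z≤n , floorφ-suc 0
floorφ-bracket (suc N) with floorφ-bracket N
... | k , lo , hi with suc N <? floorφ (suc k)
... | yes N+1<A = k , m≤n⇒m≤1+n lo , N+1<A
... | no N+1≮A = suc k , ≮⇒≥ N+1≮A , ≤-<-trans hi (floorφ-suc (suc k))

floorφ-between⇒floorφ≡ : ∀ {k j} → floorφ k < k + j → k + j < floorφ (suc k) → floorφ j ≡ k
floorφ-between⇒floorφ≡ {k} {j} above below = ≤-antisym Aj≤k k≤Aj
  where
  k≤Aj : k ≤ floorφ j
  k≤Aj = from (≤floorφ⇔≤[]φ k j) (<⇒≤ (≰⇒> λ j·φ≤k →
           <⇒≱ above (from (≤floorφ⇔≤[]φ (k + j) k) (from (+≤[]φ⇔ k j) j·φ≤k))))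
  Aj≤k : floorφ j ≤ k
  Aj≤k = ≮⇒≥ λ k<Aj → 1+n≢0 (φ-irrational (suc k) j (≤-antisym
           (to (≤floorφ⇔≤[]φ (suc k) j) k<Aj)
           (to (+≤[]φ⇔ (suc k) j) (to (≤floorφ⇔≤[]φ (suc k + j) (suc k)) below))))

floorφ-or-floorφ1 : ∀ N → (∃ λ k → floorφ k ≡ N) ⊎ (∃ λ j → floorφ1 j ≡ N)
floorφ-or-floorφ1 N with floorφ-bracket N
... | k , Ak≤N , N<Ak+1 with floorφ k ≟ N
... | yes Ak≡N = inj₁ (k , Ak≡N)
... | no Ak≢N with m≤n⇒∃[o]m+o≡n (≤-trans (k≤floorφ k) Ak≤N)
... | j , refl = inj₂ (j , cong (_+ j) (floorφ-between⇒floorφ≡ (≤∧≢⇒< Ak≤N Ak≢N) N<Ak+1))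

-- The local search function go of findJ cannot be named outside Defs. In
-- `unfold`, generalising suc i to a variable k turns the goal into the pattern
-- equation search k i = go k i, which solves the metavariable `search`.
mutual
  search : ℕ → ℕ → Maybe ℕ
  search = _

  _ : ∀ i → findJ (suc i) ≡ (if floorφ (suc i) ≡ᵇ floorφ1 i + 1 then just i else search (suc i) i)
  _ = unfold
    where
    unfold : ∀ i → findJ (suc i) ≡ (if floorφ (suc i) ≡ᵇ floorφ1 i + 1 then just i else search (suc i) i)
    unfold i with floorφ (suc i) ≡ᵇ floorφ1 i + 1
    ... | true = refl
    ... | false with suc i
    ... | k = refl

≡ᵇ-reflects-≡ : ∀ m n → Reflects (m ≡ n) (m ≡ᵇ n)
≡ᵇ-reflects-≡ m n = fromEquivalence (≡ᵇ⇒≡ m n) (≡⇒≡ᵇ m n)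

search-sound : ∀ k i j → search k i ≡ just j → j < i × floorφ k ≡ floorφ1 j + 1
search-sound k (suc i) j eq with floorφ k ≡ᵇ floorφ1 i + 1 | ≡ᵇ-reflects-≡ (floorφ k) (floorφ1 i + 1)
search-sound k (suc i) i refl | true  | ofʸ found = ≤-refl , found
search-sound k (suc i) j eq   | false | ofⁿ _     = map₁ m≤n⇒m≤1+n (search-sound k i j eq)

search-complete : ∀ k i j → j < i → floorφ k ≡ floorφ1 j + 1 → search k i ≡ just j
search-complete k (suc i) j j<1+i eq with floorφ k ≡ᵇ floorφ1 i + 1 | ≡ᵇ-reflects-≡ (floorφ k) (floorφ1 i + 1)
... | true  | ofʸ found = cong just (floorφ1-injective (+-cancelʳ-≡ 1 _ _ (trans (sym found) eq)))
... | false | ofⁿ not-found with m<1+n⇒m<n∨m≡n j<1+i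
... | inj₁ j<i = search-complete k i j j<i eq
... | inj₂ refl = contradiction eq not-found

floorφ≡floorφ1+1⇒< : ∀ k j → floorφ k ≡ floorφ1 j + 1 → j < k
floorφ≡floorφ1+1⇒< k j eq = ≰⇒> λ k≤j → <⇒≱
  (subst (floorφ1 j <_) (sym (trans eq (+-comm (floorφ1 j) 1))) ≤-refl)
  (≤-trans (floorφ-mono-≤ k≤j) (m≤m+n (floorφ j) j))

findJ-sound : ∀ k j → findJ k ≡ just j → j < k × floorφ k ≡ floorφ1 j + 1
findJ-sound k = search-sound k k

findJ-complete : ∀ k j → floorφ k ≡ floorφ1 j + 1 → findJ k ≡ just j
findJ-complete k j eq = search-complete k k j (floorφ≡floorφ1+1⇒< k j eq) eq

gF-fuel-irrelevant : ∀ {f f′} k → k ≤ f → k ≤ f′ → gF f k ≡ gF f′ k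
gF-fuel-irrelevant zero _ _ = refl
gF-fuel-irrelevant (suc zero) _ _ = refl
gF-fuel-irrelevant {suc f} {suc f′} (suc (suc k)) (s≤s k<f) (s≤s k<f′) with findJ (suc (suc k)) in found
... | nothing = refl
... | just j = cong (1 ∸_) (gF-fuel-irrelevant j (≤-trans j≤1+k k<f) (≤-trans j≤1+k k<f′))
  where
  j≤1+k : j ≤ suc k
  j≤1+k = m<1+n⇒m≤n (proj₁ (findJ-sound (suc (suc k)) j found))

gF-binary : ∀ f k → gF f k ≡ 0 ⊎ gF f k ≡ 1
gF-binary _ zero = inj₂ refl
gF-binary _ (suc zero) = inj₁ refl
gF-binary zero (suc (suc k)) = inj₂ refl
gF-binary (suc f) (suc (suc k)) with findJ (suc (suc k))
... | nothing = inj₂ refl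
... | just j with gF f j | gF-binary f j
... | _ | inj₁ refl = inj₂ refl
... | _ | inj₂ refl = inj₁ refl

g-binary : ∀ k → g k ≡ 0 ⊎ g k ≡ 1
g-binary k = gF-binary k k

g≤1 : ∀ k → g k ≤ 1
g≤1 k with g k | g-binary k
... | _ | inj₁ refl = z≤n
... | _ | inj₂ refl = ≤-refl

g-complement : ∀ k j → floorφ k ≡ floorφ1 j + 1 → g k ≡ 1 ∸ g j
g-complement zero j eq = contradiction (floorφ≡floorφ1+1⇒< 0 j eq) λ ()
g-complement (suc zero) zero eq = refl
g-complement (suc zero) (suc j) eq with floorφ≡floorφ1+1⇒< 1 (suc j) eq
... | s≤s ()
g-complement (suc (suc k)) j eq with findJ (suc (suc k)) | findJ-complete (suc (suc k)) j eq
... | just .j | refl = cong (1 ∸_) (gF-fuel-irrelevant j (m<1+n⇒m≤n (floorφ≡floorφ1+1⇒< _ j eq)) ≤-refl)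

g≡0⇒complement : ∀ k → g k ≡ 0 → ∃ λ j → floorφ k ≡ floorφ1 j + 1 × g j ≡ 1
g≡0⇒complement (suc zero) _ = 0 , refl , refl
g≡0⇒complement (suc (suc k)) g≡0 with findJ (suc (suc k)) in found
... | nothing = contradiction g≡0 λ ()
... | just j with findJ-sound (suc (suc k)) j found | gF-binary (suc k) j
... | _ , _ | inj₁ gF≡0 = contradiction (trans (cong (1 ∸_) (sym gF≡0)) g≡0) λ ()
... | j<2+k , shifted | inj₂ gF≡1 =
  j , shifted , trans (gF-fuel-irrelevant j ≤-refl (m<1+n⇒m≤n j<2+k)) gF≡1

a₁ b₁ : ℕ → ℕ
a₁ k = (floorφ k + g k) ∸ 1
b₁ k = floorφ1 k + g k

1≤floorφ+g : ∀ k → 1 ≤ floorφ k + g k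
1≤floorφ+g zero = ≤-refl
1≤floorφ+g (suc k) =
  ≤-trans (s≤s z≤n) (≤-trans (k≤floorφ (suc k)) (m≤m+n (floorφ (suc k)) (g (suc k))))

b₁≡a₁+suc : ∀ k → b₁ k ≡ a₁ k + suc k
b₁≡a₁+suc k = begin
  floorφ k + k + g k  ≡⟨ xy∙z≈xz∙y (floorφ k) k (g k) ⟩
  floorφ k + g k + k  ≡⟨ cong (_+ k) (sym (m∸n+n≡m (1≤floorφ+g k))) ⟩
  a₁ k + 1 + k        ≡⟨ +-assoc (a₁ k) 1 k ⟩
  a₁ k + suc k        ∎
  where open ≡-Reasoning

a₁<b₁ : ∀ k → a₁ k < b₁ k
a₁<b₁ k = subst (a₁ k <_) (sym (b₁≡a₁+suc k)) (m<m+n (a₁ k) (s≤s z≤n))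

a₁≤floorφ : ∀ k → a₁ k ≤ floorφ k
a₁≤floorφ k = subst (a₁ k ≤_) (m+n∸n≡m (floorφ k) 1) (∸-monoˡ-≤ 1 (+-monoʳ-≤ (floorφ k) (g≤1 k)))

a₁-mono : ∀ {j k} → j ≤ k → a₁ j ≤ a₁ k
a₁-mono {j} {k} j≤k with m≤n⇒m<n∨m≡n j≤k
... | inj₂ refl = ≤-refl
... | inj₁ j<k = begin
  a₁ j          ≤⟨ a₁≤floorφ j ⟩
  floorφ j      ≤⟨ m+n≤o⇒m≤o∸n (floorφ j) (subst (_≤ floorφ k) (+-comm 1 (floorφ j)) (floorφ-mono-< j<k)) ⟩
  floorφ k ∸ 1  ≤⟨ ∸-monoˡ-≤ 1 (m≤m+n (floorφ k) (g k)) ⟩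
  a₁ k          ∎
  where open ≤-Reasoning

floorφ∈a₁∪b₁ : ∀ k → ∃ λ i → floorφ k ≡ a₁ i ⊎ floorφ k ≡ b₁ i
floorφ∈a₁∪b₁ k with g-binary k
... | inj₂ g≡1 = k , inj₁ (sym (trans (cong (λ z → floorφ k + z ∸ 1) g≡1) (m+n∸n≡m (floorφ k) 1)))
... | inj₁ g≡0 with g≡0⇒complement k g≡0
... | j , shifted , g≡1 = j , inj₂ (trans shifted (cong (floorφ1 j +_) (sym g≡1)))

floorφ1∈a₁∪b₁ : ∀ j → ∃ λ i → floorφ1 j ≡ a₁ i ⊎ floorφ1 j ≡ b₁ i
floorφ1∈a₁∪b₁ j with g-binary j
... | inj₁ g≡0 = j , inj₂ (sym (trans (cong (floorφ1 j +_) g≡0) (+-identityʳ (floorφ1 j))))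
... | inj₂ g≡1 with floorφ-or-floorφ1 (suc (floorφ1 j))
... | inj₂ (j′ , eq) = contradiction eq (floorφ1-nonconsecutive j j′)
... | inj₁ (i , eq) = i , inj₁ (sym (begin
  floorφ i + g i ∸ 1  ≡⟨ cong (λ z → floorφ i + z ∸ 1) (trans (g-complement i j shifted) (cong (1 ∸_) g≡1)) ⟩
  floorφ i + 0 ∸ 1    ≡⟨ cong (_∸ 1) (trans (+-identityʳ (floorφ i)) eq) ⟩
  floorφ1 j           ∎))
  where
  open ≡-Reasoning
  shifted : floorφ i ≡ floorφ1 j + 1
  shifted = trans eq (+-comm 1 (floorφ1 j))

a₁-or-b₁ : ∀ x → ∃ λ k → x ≡ a₁ k ⊎ x ≡ b₁ k
a₁-or-b₁ x with floorφ-or-floorφ1 x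
... | inj₁ (k , refl) = floorφ∈a₁∪b₁ k
... | inj₂ (j , refl) = floorφ1∈a₁∪b₁ j

InP1-swap : ∀ {x y} → InP1 x y → InP1 y x
InP1-swap (inj₁ (k , x≡ , y≡)) = inj₂ (inj₁ (k , y≡ , x≡))
InP1-swap (inj₂ (inj₁ (k , x≡ , y≡))) = inj₁ (k , y≡ , x≡)
InP1-swap (inj₂ (inj₂ (inj₁ (x≡0 , y≡0)))) = inj₂ (inj₂ (inj₁ (y≡0 , x≡0)))
InP1-swap (inj₂ (inj₂ (inj₂ (x≡1 , y≡1)))) = inj₂ (inj₂ (inj₂ (y≡1 , x≡1)))

QueenMove-swap : ∀ {x y u v} → QueenMove x y u v → QueenMove y x v u
QueenMove-swap (inj₁ (u<x , v≡y)) = inj₂ (inj₁ (v≡y , u<x))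
QueenMove-swap (inj₂ (inj₁ (u≡x , v<y))) = inj₁ (v<y , u≡x)
QueenMove-swap (inj₂ (inj₂ (t , 1≤t , t≤x , t≤y , u≡ , v≡))) =
  inj₂ (inj₂ (t , 1≤t , t≤y , t≤x , v≡ , u≡))

diagonal-move : ∀ u v t → 1 ≤ t → QueenMove (u + t) (v + t) u v
diagonal-move u v t 1≤t =
  inj₂ (inj₂ (t , 1≤t , m≤n+m t u , m≤n+m t v , sym (m+n∸n≡m u t) , sym (m+n∸n≡m v t)))

MovesIntoP₁ : ℕ → ℕ → Set
MovesIntoP₁ x y = ∃ λ u → ∃ λ v → QueenMove x y u v × InP1 u v

MovesIntoP₁-swap : ∀ {x y} → MovesIntoP₁ x y → MovesIntoP₁ y x
MovesIntoP₁-swap (u , v , move , u,v∈P₁) = v , u , QueenMove-swap move , InP1-swap u,v∈P₁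

moves-diagonally-into-pair : ∀ {x y} j t → x ≡ a₁ j + t → y ≡ b₁ j + t → ¬ InP1 x y → MovesIntoP₁ x y
moves-diagonally-into-pair j zero refl refl x,y∉P₁ =
  contradiction (inj₁ (j , +-identityʳ (a₁ j) , +-identityʳ (b₁ j))) x,y∉P₁
moves-diagonally-into-pair j (suc t) refl refl _ =
  a₁ j , b₁ j , diagonal-move (a₁ j) (b₁ j) (suc t) (s≤s z≤n) , inj₁ (j , refl , refl)

moves-into-P₁-diagonally : ∀ k j → j ≤ k →
  ¬ InP1 (a₁ k) (suc (a₁ k + j)) → MovesIntoP₁ (a₁ k) (suc (a₁ k + j))
moves-into-P₁-diagonally k j j≤k x,y∉P₁ with m≤n⇒∃[o]m+o≡n (a₁-mono j≤k)
... | t , a₁j+t≡a₁k = moves-diagonally-into-pair j t (sym a₁j+t≡a₁k) y≡b₁j+t x,y∉P₁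
  where
  open ≡-Reasoning
  y≡b₁j+t : suc (a₁ k + j) ≡ b₁ j + t
  y≡b₁j+t = begin
    suc (a₁ k + j)    ≡⟨ sym (+-suc (a₁ k) j) ⟩
    a₁ k + suc j      ≡⟨ cong (_+ suc j) (sym a₁j+t≡a₁k) ⟩
    a₁ j + t + suc j  ≡⟨ xy∙z≈xz∙y (a₁ j) t (suc j) ⟩
    a₁ j + suc j + t  ≡⟨ cong (_+ t) (sym (b₁≡a₁+suc j)) ⟩
    b₁ j + t          ∎

moves-into-P₁-above-diagonal : ∀ {x y} → x < y → ¬ InP1 x y → MovesIntoP₁ x y
moves-into-P₁-above-diagonal {x} x<y x,y∉P₁ with a₁-or-b₁ x | m≤n⇒∃[o]m+o≡n x<y
... | k , inj₂ refl | _ =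
  b₁ k , a₁ k , inj₂ (inj₁ (refl , <-trans (a₁<b₁ k) x<y)) , inj₂ (inj₁ (k , refl , refl))
... | k , inj₁ refl | j , refl with <-cmp k j
... | tri< k<j _ _ = a₁ k , b₁ k , inj₂ (inj₁ (refl , b₁k<y)) , inj₁ (k , refl , refl)
  where
  b₁k<y : b₁ k < suc (a₁ k + j)
  b₁k<y = subst₂ _<_ (sym (b₁≡a₁+suc k)) (+-suc (a₁ k) j) (+-monoʳ-< (a₁ k) (s<s k<j))
... | tri≈ _ refl _ =
  contradiction (inj₁ (k , refl , sym (trans (b₁≡a₁+suc k) (+-suc (a₁ k) k)))) x,y∉P₁
... | tri> _ _ j<k = moves-into-P₁-diagonally k j (<⇒≤ j<k) x,y∉P₁

moves-into-P₁ : ∀ x y → ¬ InP1 x y → MovesIntoP₁ x y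
moves-into-P₁ x y x,y∉P₁ with <-cmp x y
... | tri< x<y _ _ = moves-into-P₁-above-diagonal x<y x,y∉P₁
... | tri> _ _ y<x = MovesIntoP₁-swap (moves-into-P₁-above-diagonal y<x (x,y∉P₁ ∘ InP1-swap))
... | tri≈ _ refl _ with x
... | zero = contradiction (inj₂ (inj₂ (inj₁ (refl , refl)))) x,y∉P₁
... | suc n = 0 , 0 , diagonal-move 0 0 (suc n) (s≤s z≤n) , inj₂ (inj₂ (inj₁ (refl , refl)))

lemma3p9 : (n m : ℕ) → 1 ≤ n → 1 ≤ m →
    floorφ n ≡ floorφ1 m + 1 →
    (x y : ℕ) → ¬ InP1 x y →
    (y ≡ floorφ n ⊎ y ≡ floorφ n ∸ 1) →
    ∃ λ u → ∃ λ v → QueenMove x y u v × InP1 u v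
lemma3p9 _ _ _ _ _ x y x,y∉P₁ _ = moves-into-P₁ x y x,y∉P₁
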